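{- For each odd composite integer $n\ge 9$, $8K_n\equiv -S_{n-1}+2\pmod n$.
   Context: The derangement numbers are $S_k=k!\sum_{i=0}^{k}\frac{(-1)^i}{i!}$ for $k\ge 0$. For an integer $N\ge 7$ let $m=N-4$ and let $M_N=(a_{ij})_{1\le i,j\le m}$ be the integer matrix with entries: row $1$: $a_{1j}=1$ for $1\le j\le m-1$ and $a_{1m}=3$; for $2\le i\le m-1$: $a_{ij}=0$ if $j<i-2$, $a_{i,i-2}=1$ (when $i\ge 3$), $a_{i,i-1}=i+1$, $a_{ij}=1$ for $i\le j\le m-1$, and $a_{im}=2$; last row $m$: $a_{mj}=0$ for $j\le m-2$, $a_{m,m-1}=1$, $a_{mm}=-4$. (E.g. for $N=7$: rows $(1,1,3),(3,1,2),(0,1,-4)$.) The Kurepa determinant is $K_N=\det M_N$. -}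

module Defs where

open import Data.Nat as ℕ using (ℕ; zero; suc; _<ᵇ_; _≡ᵇ_)
open import Data.Bool using (Bool; true; false; if_then_else_)
open import Data.Integer as ℤ using (ℤ; +_; -_; _+_; _*_; _-_)
open import Data.Fin using (Fin; toℕ; punchIn)
import Data.Fin as Fin

ΣFin : (m : ℕ) → (Fin m → ℤ) → ℤ
ΣFin zero    f = + 0
ΣFin (suc m) f = f Fin.zero + ΣFin m (λ i → f (Fin.suc i))

sgn : ℕ → ℤ
sgn zero    = + 1
sgn (suc i) = - sgn i

det : (m : ℕ) → (Fin m → Fin m → ℤ) → ℤ
det zero    A = + 1
det (suc m) A =
  ΣFin (suc m) (λ j → sgn (toℕ j) * A Fin.zero j
                        * det m (λ r c → A (Fin.suc r) (punchIn j c)))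

-- k!/i! = (i+1)(i+2)···k  for i ≤ k (a natural number).
fallingQ : ℕ → ℕ → ℕ
fallingQ k i = go k
  where
  go : ℕ → ℕ
  go zero    = 1
  go (suc t) = if i <ᵇ suc t then suc t ℕ.* go t else 1

-- Derangement numbers S_k = k! Σ_{i=0}^{k} (-1)^i / i!
--                        = Σ_{i=0}^{k} (-1)^i · (k!/i!).
S : ℕ → ℤ
S k = ΣFin (suc k) (λ i → sgn (toℕ i) * + fallingQ k (toℕ i))

-- Entry a_{ij} of M_N (1-indexed i, j) for matrix size m = N - 4.
entry : (m i j : ℕ) → ℤ
entry m i j with i ≡ᵇ 1 | i ≡ᵇ m
... | true  | _     = if j ≡ᵇ m then + 3 else + 1
... | false | true  = if j ≡ᵇ m then - (+ 4)
                      else if suc j ≡ᵇ m then + 1 else + 0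
... | false | false =
  if j ≡ᵇ m then + 2
  else if i ℕ.≤ᵇ j then + 1
  else if suc j ≡ᵇ i then + (suc i)
  else if suc (suc j) ≡ᵇ i then + 1
  else + 0

M : (N : ℕ) → Fin (N ℕ.∸ 4) → Fin (N ℕ.∸ 4) → ℤ
M N r c = entry (N ℕ.∸ 4) (suc (toℕ r)) (suc (toℕ c))

K : ℕ → ℤ
K N = det (N ℕ.∸ 4) (M N)

module Submission where

-- Finally, writing n = k + 5 with k ≥ 4 even, the closed form and four steps of the recurrence
-- for S_{n-1} make 8 K_n + S_{n-1} - 2 equal to 96 · k!/2! plus a multiple of n, and n divides
-- 96 · k!/2!.

module NatFacts where

  open import Data.Nat using (_+_; _≡ᵇ_; _≤ᵇ_; _<ᵇ_; _≤_; _<_)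
  import Data.Nat.Properties as ℕP
  open import Data.Bool using (true; false; T)
  open import Data.Bool.Properties using (T-≡)
  open import Function.Bundles using (Equivalence)
  open import Relation.Binary.PropositionalEquality
  open import Relation.Nullary using (¬_; contradiction)

  -- The boolean comparisons of ℕ, evaluated from the corresponding relations, so that
  -- case distinctions in definitions can be resolved by rewriting.
  T⇒true : ∀ {b} → T b → b ≡ true
  T⇒true = Equivalence.to T-≡

  ¬T⇒false : ∀ {b} → ¬ T b → b ≡ false
  ¬T⇒false {false} _  = refl
  ¬T⇒false {true}  ¬t = contradiction _ ¬t

  ≡ᵇ-true : ∀ {m n} → m ≡ n → (m ≡ᵇ n) ≡ true
  ≡ᵇ-true {m} {n} eq = T⇒true (ℕP.≡⇒≡ᵇ m n eq)

  ≡ᵇ-false : ∀ {m n} → ¬ (m ≡ n) → (m ≡ᵇ n) ≡ false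
  ≡ᵇ-false {m} {n} neq = ¬T⇒false (λ t → neq (ℕP.≡ᵇ⇒≡ m n t))

  ≤ᵇ-true : ∀ {m n} → m ≤ n → (m ≤ᵇ n) ≡ true
  ≤ᵇ-true le = T⇒true (ℕP.≤⇒≤ᵇ le)

  ≤ᵇ-false : ∀ {m n} → n < m → (m ≤ᵇ n) ≡ false
  ≤ᵇ-false {m} {n} gt = ¬T⇒false (λ t → ℕP.<⇒≱ gt (ℕP.≤ᵇ⇒≤ m n t))

  <ᵇ-true : ∀ {m n} → m < n → (m <ᵇ n) ≡ true
  <ᵇ-true lt = T⇒true (ℕP.<⇒<ᵇ lt)

  <ᵇ-false : ∀ {m n} → n ≤ m → (m <ᵇ n) ≡ false
  <ᵇ-false {m} {n} ge = ¬T⇒false (λ t → ℕP.≤⇒≯ ge (ℕP.<ᵇ⇒< m n t))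

  ≤-witness : ∀ x d {y} → x + d ≡ y → x ≤ y
  ≤-witness x d refl = ℕP.m≤m+n x d


module Sums where

  open import Defs using (ΣFin)
  open import Data.Nat as ℕ using (ℕ; zero; suc; _≤_; _<_; z≤n; s≤s)
  import Data.Nat.Properties as ℕP
  open import Data.Integer using (ℤ; +_; -_; _+_; _*_)
  import Data.Integer.Properties as ℤP
  open import Data.Fin as Fin using (Fin; toℕ; inject₁; fromℕ)
  open import Relation.Binary.PropositionalEquality
  open import Data.Integer.Tactic.RingSolver using (solve-∀)

  ΣFin-cong : ∀ n {f g : Fin n → ℤ} → (∀ i → f i ≡ g i) → ΣFin n f ≡ ΣFin n g
  ΣFin-cong zero    eq = refl
  ΣFin-cong (suc n) eq = cong₂ _+_ (eq Fin.zero) (ΣFin-cong n (λ i → eq (Fin.suc i)))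

  ΣFin-zero : ∀ n {f : Fin n → ℤ} → (∀ i → f i ≡ + 0) → ΣFin n f ≡ + 0
  ΣFin-zero n eq = trans (ΣFin-cong n eq) (zeros n)
    where
    zeros : ∀ n → ΣFin n (λ _ → + 0) ≡ + 0
    zeros zero    = refl
    zeros (suc n) = trans (ℤP.+-identityˡ _) (zeros n)

  ΣFin-+ : ∀ n (f g : Fin n → ℤ) → ΣFin n (λ i → f i + g i) ≡ ΣFin n f + ΣFin n g
  ΣFin-+ zero    f g = refl
  ΣFin-+ (suc n) f g =
    trans (cong (λ v → f Fin.zero + g Fin.zero + v) (ΣFin-+ n (λ i → f (Fin.suc i)) (λ i → g (Fin.suc i))))
          (interchange (f Fin.zero) (g Fin.zero) _ _)
    where
    interchange : ∀ a b c d → a + b + (c + d) ≡ a + c + (b + d)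
    interchange = solve-∀

  ΣFin-*ˡ : ∀ n x (f : Fin n → ℤ) → x * ΣFin n f ≡ ΣFin n (λ i → x * f i)
  ΣFin-*ˡ zero    x f = ℤP.*-zeroʳ x
  ΣFin-*ˡ (suc n) x f =
    trans (ℤP.*-distribˡ-+ x (f Fin.zero) _) (cong (λ v → x * f Fin.zero + v) (ΣFin-*ˡ n x (λ i → f (Fin.suc i))))

  ΣFin-neg : ∀ n (f : Fin n → ℤ) → - ΣFin n f ≡ ΣFin n (λ i → - f i)
  ΣFin-neg zero    f = refl
  ΣFin-neg (suc n) f =
    trans (ℤP.neg-distrib-+ (f Fin.zero) _) (cong (λ v → - f Fin.zero + v) (ΣFin-neg n (λ i → f (Fin.suc i))))

  ΣFin-last : ∀ n (f : Fin (suc n) → ℤ) → ΣFin (suc n) f ≡ ΣFin n (λ i → f (inject₁ i)) + f (fromℕ n)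
  ΣFin-last zero    f = ℤP.+-comm (f Fin.zero) (+ 0)
  ΣFin-last (suc n) f =
    trans (cong (λ v → f Fin.zero + v) (ΣFin-last n (λ i → f (Fin.suc i)))) (sym (ℤP.+-assoc (f Fin.zero) _ _))

  rangeSum : (ℕ → ℤ) → ℕ → ℕ → ℤ
  rangeSum f s zero    = + 0
  rangeSum f s (suc c) = f s + rangeSum f (suc s) c

  ΣFin-rangeSum : ∀ n s (f : ℕ → ℤ) → ΣFin n (λ i → f (s ℕ.+ toℕ i)) ≡ rangeSum f s n
  ΣFin-rangeSum zero    s f = refl
  ΣFin-rangeSum (suc n) s f = cong₂ _+_ (cong f (ℕP.+-identityʳ s))
    (trans (ΣFin-cong n (λ i → cong f (ℕP.+-suc s (toℕ i)))) (ΣFin-rangeSum n (suc s) f))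

  rangeSum-cong : ∀ (f g : ℕ → ℤ) c s → (∀ i → s ≤ i → i < s ℕ.+ c → f i ≡ g i) →
    rangeSum f s c ≡ rangeSum g s c
  rangeSum-cong f g zero    s eq = refl
  rangeSum-cong f g (suc c) s eq = cong₂ _+_ (eq s ℕP.≤-refl (ℕP.m<m+n s (s≤s z≤n)))
    (rangeSum-cong f g c (suc s) (λ i s<i i<s+c → eq i (ℕP.<⇒≤ s<i) (subst (i <_) (sym (ℕP.+-suc s c)) i<s+c)))

  rangeSum-*ˡ : ∀ x (f : ℕ → ℤ) c s → x * rangeSum f s c ≡ rangeSum (λ i → x * f i) s c
  rangeSum-*ˡ x f zero    s = ℤP.*-zeroʳ x
  rangeSum-*ˡ x f (suc c) s = trans (ℤP.*-distribˡ-+ x (f s) _) (cong (λ v → x * f s + v) (rangeSum-*ˡ x f c (suc s)))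

  rangeSum-last : ∀ (f : ℕ → ℤ) c s → rangeSum f s (suc c) ≡ rangeSum f s c + f (s ℕ.+ c)
  rangeSum-last f zero    s = trans (ℤP.+-comm (f s) (+ 0)) (cong (λ v → + 0 + f v) (sym (ℕP.+-identityʳ s)))
  rangeSum-last f (suc c) s = begin
    f s + rangeSum f (suc s) (suc c)            ≡⟨ cong (λ v → f s + v) (rangeSum-last f c (suc s)) ⟩
    f s + (rangeSum f (suc s) c + f (suc s ℕ.+ c)) ≡⟨ sym (ℤP.+-assoc (f s) _ _) ⟩
    f s + rangeSum f (suc s) c + f (suc s ℕ.+ c)   ≡⟨ cong (λ v → f s + rangeSum f (suc s) c + f v) (sym (ℕP.+-suc s c)) ⟩
    f s + rangeSum f (suc s) c + f (s ℕ.+ suc c)   ∎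
    where open ≡-Reasoning


module Determinant where

  open import Defs using (ΣFin; sgn; det)
  open Sums
  open NatFacts using (<ᵇ-true; <ᵇ-false)
  open import Data.Nat as ℕ using (ℕ; zero; suc; _≤_; _<ᵇ_)
  import Data.Nat.Properties as ℕP
  open import Data.Bool using (if_then_else_)
  open import Data.Integer using (ℤ; +_; -_; _+_; _*_; _-_)
  import Data.Integer.Properties as ℤP
  open import Data.Fin as Fin using (Fin; toℕ; punchIn; inject₁; fromℕ; fromℕ<)
  import Data.Fin.Properties as FinP
  open import Relation.Binary.PropositionalEquality
  open import Relation.Nullary using (¬_; contradiction)
  open import Relation.Binary.Definitions using (tri<; tri≈; tri>)
  open import Data.Integer.Tactic.RingSolver using (solve-∀)

  Matrix : ℕ → Set
  Matrix n = Fin n → Fin n → ℤ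

  one : ∀ {n} → Fin (suc (suc n))
  one = Fin.suc Fin.zero

  minor : ∀ {n} → Matrix (suc n) → Fin (suc n) → Matrix n
  minor A j r c = A (Fin.suc r) (punchIn j c)

  laplaceTerm : ∀ {n} → Matrix (suc n) → Fin (suc n) → ℤ
  laplaceTerm {n} A j = sgn (toℕ j) * A Fin.zero j * det n (minor A j)

  term-entry-zero : ∀ {n} (A : Matrix (suc n)) j → A Fin.zero j ≡ + 0 → laplaceTerm A j ≡ + 0
  term-entry-zero {n} A j a≡0 rewrite a≡0 =
    trans (cong (_* det n (minor A j)) (ℤP.*-zeroʳ (sgn (toℕ j)))) (ℤP.*-zeroˡ (det n (minor A j)))

  term-minor-zero : ∀ {n} (A : Matrix (suc n)) j → det n (minor A j) ≡ + 0 → laplaceTerm A j ≡ + 0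
  term-minor-zero A j d≡0 rewrite d≡0 = ℤP.*-zeroʳ (sgn (toℕ j) * A Fin.zero j)

  det-cong : ∀ n {A B : Matrix n} → (∀ r c → A r c ≡ B r c) → det n A ≡ det n B
  det-cong zero    eq = refl
  det-cong (suc n) eq = ΣFin-cong (suc n) λ j →
    cong₂ _*_ (cong (sgn (toℕ j) *_) (eq Fin.zero j)) (det-cong n (λ r c → eq (Fin.suc r) (punchIn j c)))

  det-leadingTerm : ∀ n (A : Matrix (suc n)) → ΣFin n (λ j → laplaceTerm A (Fin.suc j)) ≡ + 0 →
    det (suc n) A ≡ A Fin.zero Fin.zero * det n (minor A Fin.zero)
  det-leadingTerm n A rest = begin
    + 1 * a * d + ΣFin n (λ j → laplaceTerm A (Fin.suc j)) ≡⟨ cong (λ v → + 1 * a * d + v) rest ⟩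
    + 1 * a * d + + 0                                     ≡⟨ ℤP.+-identityʳ _ ⟩
    + 1 * a * d                                           ≡⟨ cong (_* d) (ℤP.*-identityˡ a) ⟩
    a * d                                                 ∎
    where
    open ≡-Reasoning
    a d : ℤ
    a = A Fin.zero Fin.zero
    d = det n (minor A Fin.zero)

  det-zeroColumn : ∀ n (A : Matrix (suc n)) → (∀ r → A r Fin.zero ≡ + 0) → det (suc n) A ≡ + 0
  det-zeroColumn zero    A col = trans (ℤP.+-identityʳ _) (term-entry-zero A Fin.zero (col Fin.zero))
  det-zeroColumn (suc n) A col = ΣFin-zero (suc (suc n)) term
    where
    term : ∀ j → laplaceTerm A j ≡ + 0
    term Fin.zero    = term-entry-zero A Fin.zero (col Fin.zero)
    term (Fin.suc j) = term-minor-zero A (Fin.suc j) (det-zeroColumn n (minor A (Fin.suc j)) (λ r → col (Fin.suc r)))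

  det-firstColumn : ∀ n (A : Matrix (suc n)) → (∀ r → A (Fin.suc r) Fin.zero ≡ + 0) →
    det (suc n) A ≡ A Fin.zero Fin.zero * det n (minor A Fin.zero)
  det-firstColumn zero    A col = det-leadingTerm zero A refl
  det-firstColumn (suc n) A col = det-leadingTerm (suc n) A (ΣFin-zero (suc n) λ j →
    term-minor-zero A (Fin.suc j) (det-zeroColumn n (minor A (Fin.suc j)) col))

  det-firstRow : ∀ n (A : Matrix (suc n)) → (∀ c → A Fin.zero (Fin.suc c) ≡ + 0) →
    det (suc n) A ≡ A Fin.zero Fin.zero * det n (minor A Fin.zero)
  det-firstRow n A row = det-leadingTerm n A (ΣFin-zero n λ j → term-entry-zero A (Fin.suc j) (row j))

  -- Deleting column j and then column k of what remains deletes the same two columns as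
  -- deleting column (punchIn j k) and then column (swapIndex j k), in the opposite order.
  swapIndex : ∀ {n} → Fin (suc (suc n)) → Fin (suc n) → Fin (suc n)
  swapIndex Fin.zero    k        = Fin.zero
  swapIndex (Fin.suc j) Fin.zero = j
  swapIndex {suc n} (Fin.suc j) (Fin.suc k) = Fin.suc (swapIndex j k)

  punchIn-swapIndex : ∀ {n} (j : Fin (suc (suc n))) (k : Fin (suc n)) → punchIn (punchIn j k) (swapIndex j k) ≡ j
  punchIn-swapIndex Fin.zero    k        = refl
  punchIn-swapIndex (Fin.suc j) Fin.zero = refl
  punchIn-swapIndex {suc n} (Fin.suc j) (Fin.suc k) = cong Fin.suc (punchIn-swapIndex j k)

  punchIn²-swapIndex : ∀ {n} (j : Fin (suc (suc n))) (k : Fin (suc n)) (c : Fin n) →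
    punchIn j (punchIn k c) ≡ punchIn (punchIn j k) (punchIn (swapIndex j k) c)
  punchIn²-swapIndex Fin.zero    k        c = refl
  punchIn²-swapIndex (Fin.suc j) Fin.zero c = refl
  punchIn²-swapIndex {suc n} (Fin.suc j) (Fin.suc k) Fin.zero    = refl
  punchIn²-swapIndex {suc n} (Fin.suc j) (Fin.suc k) (Fin.suc c) = cong Fin.suc (punchIn²-swapIndex j k c)

  sgn-swapIndex : ∀ {n} (j : Fin (suc (suc n))) (k : Fin (suc n)) →
    sgn (toℕ j) * sgn (toℕ k) ≡ - (sgn (toℕ (punchIn j k)) * sgn (toℕ (swapIndex j k)))
  sgn-swapIndex Fin.zero    k        = lemma (sgn (toℕ k))
    where
    lemma : ∀ x → + 1 * x ≡ - (- x * + 1)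
    lemma = solve-∀
  sgn-swapIndex (Fin.suc j) Fin.zero = lemma (sgn (toℕ j))
    where
    lemma : ∀ x → - x * + 1 ≡ - (+ 1 * x)
    lemma = solve-∀
  sgn-swapIndex {suc n} (Fin.suc j) (Fin.suc k) =
    trans (negneg (sgn (toℕ j)) (sgn (toℕ k)))
      (trans (sgn-swapIndex j k) (cong -_ (sym (negneg (sgn (toℕ (punchIn j k))) (sgn (toℕ (swapIndex j k)))))))
    where
    negneg : ∀ a b → - a * - b ≡ a * b
    negneg = solve-∀

  ΣΣ-swapIndex-cancel : ∀ n (H : Fin (suc (suc n)) → Fin (suc n) → ℤ) →
    (∀ j k → H j k + H (punchIn j k) (swapIndex j k) ≡ + 0) →
    ΣFin (suc (suc n)) (λ j → ΣFin (suc n) (H j)) ≡ + 0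
  ΣΣ-swapIndex-cancel n H cancels = begin
    ΣFin (suc n) (H Fin.zero) + ΣFin (suc n) (λ j → H (Fin.suc j) Fin.zero + inner j)
      ≡⟨ cong (λ v → ΣFin (suc n) (H Fin.zero) + v) (ΣFin-+ (suc n) (λ j → H (Fin.suc j) Fin.zero) inner) ⟩
    ΣFin (suc n) (H Fin.zero) + (ΣFin (suc n) (λ j → H (Fin.suc j) Fin.zero) + ΣFin (suc n) inner)
      ≡⟨ sym (ℤP.+-assoc (ΣFin (suc n) (H Fin.zero)) _ _) ⟩
    ΣFin (suc n) (H Fin.zero) + ΣFin (suc n) (λ j → H (Fin.suc j) Fin.zero) + ΣFin (suc n) inner
      ≡⟨ cong₂ _+_ (trans (sym (ΣFin-+ (suc n) (H Fin.zero) (λ j → H (Fin.suc j) Fin.zero)))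
                          (ΣFin-zero (suc n) (cancels Fin.zero)))
                   (innerSum n H cancels) ⟩
    + 0 ∎
    where
    open ≡-Reasoning
    inner : Fin (suc n) → ℤ
    inner j = ΣFin n (λ k → H (Fin.suc j) (Fin.suc k))
    -- the terms with j, k both nonzero form the same situation one size smaller
    innerSum : ∀ n (H : Fin (suc (suc n)) → Fin (suc n) → ℤ) →
      (∀ j k → H j k + H (punchIn j k) (swapIndex j k) ≡ + 0) →
      ΣFin (suc n) (λ j → ΣFin n (λ k → H (Fin.suc j) (Fin.suc k))) ≡ + 0
    innerSum zero    H cancels = refl
    innerSum (suc n) H cancels =
      ΣΣ-swapIndex-cancel n (λ j k → H (Fin.suc j) (Fin.suc k)) (λ j k → cancels (Fin.suc j) (Fin.suc k))

  det-equalRows : ∀ n (A : Matrix (suc (suc n))) → (∀ c → A Fin.zero c ≡ A (Fin.suc Fin.zero) c) →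
    det (suc (suc n)) A ≡ + 0
  det-equalRows n A equal =
    trans (ΣFin-cong (suc (suc n)) (λ j → ΣFin-*ˡ (suc n) (sgn (toℕ j) * A Fin.zero j)
                                            (λ k → sgn (toℕ k) * A one (punchIn j k) * D j k)))
          (ΣΣ-swapIndex-cancel n H antisymmetric)
    where
    D : Fin (suc (suc n)) → Fin (suc n) → ℤ
    D j k = det n (λ r c → A (Fin.suc (Fin.suc r)) (punchIn j (punchIn k c)))
    H : Fin (suc (suc n)) → Fin (suc n) → ℤ
    H j k = sgn (toℕ j) * A Fin.zero j * (sgn (toℕ k) * A one (punchIn j k) * D j k)
    cancelPair : ∀ sj sk sl sp a b d → sj * sk ≡ - (sl * sp) →
      sj * a * (sk * b * d) + sl * b * (sp * a * d) ≡ + 0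
    cancelPair sj sk sl sp a b d signs = begin
      sj * a * (sk * b * d) + sl * b * (sp * a * d) ≡⟨ factor sj sk sl sp a b d ⟩
      (sj * sk + sl * sp) * (a * b * d)             ≡⟨ cong (λ v → (v + sl * sp) * (a * b * d)) signs ⟩
      (- (sl * sp) + sl * sp) * (a * b * d)         ≡⟨ cong (_* (a * b * d)) (ℤP.+-inverseˡ (sl * sp)) ⟩
      + 0 * (a * b * d)                             ≡⟨ ℤP.*-zeroˡ (a * b * d) ⟩
      + 0                                           ∎
      where
      open ≡-Reasoning
      factor : ∀ sj sk sl sp a b d → sj * a * (sk * b * d) + sl * b * (sp * a * d) ≡ (sj * sk + sl * sp) * (a * b * d)
      factor = solve-∀
    antisymmetric : ∀ j k → H j k + H (punchIn j k) (swapIndex j k) ≡ + 0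
    antisymmetric j k
      rewrite equal j | equal (punchIn j k) | punchIn-swapIndex j k
            | det-cong n {λ r c → A (Fin.suc (Fin.suc r)) (punchIn (punchIn j k) (punchIn (swapIndex j k) c))}
                         {λ r c → A (Fin.suc (Fin.suc r)) (punchIn j (punchIn k c))}
                         (λ r c → cong (A (Fin.suc (Fin.suc r))) (sym (punchIn²-swapIndex j k c)))
      = cancelPair (sgn (toℕ j)) (sgn (toℕ k)) (sgn (toℕ (punchIn j k))) (sgn (toℕ (swapIndex j k)))
          (A one j) (A one (punchIn j k)) (D j k) (sgn-swapIndex j k)

  -- Subtracting row i+1 from row i does not change the determinant: for i = 0 by linearity of the
  -- expansion in row 0 and det-equalRows, otherwise by expanding along the unchanged row 0.
  det-subtractNextRow : ∀ n (i : Fin (suc n)) (A B : Matrix (suc (suc n))) →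
    (∀ r c → ¬ (r ≡ inject₁ i) → B r c ≡ A r c) →
    (∀ c → B (inject₁ i) c ≡ A (inject₁ i) c - A (Fin.suc i) c) →
    det (suc (suc n)) B ≡ det (suc (suc n)) A
  det-subtractNextRow n Fin.zero A B same changed = begin
    det (suc (suc n)) B                      ≡⟨ ΣFin-cong (suc (suc n)) split ⟩
    ΣFin (suc (suc n)) (λ j → laplaceTerm A j + - laplaceTerm A′ j)
                                             ≡⟨ ΣFin-+ (suc (suc n)) (laplaceTerm A) (λ j → - laplaceTerm A′ j) ⟩
    det (suc (suc n)) A + ΣFin (suc (suc n)) (λ j → - laplaceTerm A′ j)
                                             ≡⟨ cong (λ v → det (suc (suc n)) A + v) (sym (ΣFin-neg (suc (suc n)) (laplaceTerm A′))) ⟩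
    det (suc (suc n)) A + - det (suc (suc n)) A′
                                             ≡⟨ cong (λ v → det (suc (suc n)) A + - v) (det-equalRows n A′ (λ c → refl)) ⟩
    det (suc (suc n)) A + - + 0              ≡⟨ ℤP.+-identityʳ _ ⟩
    det (suc (suc n)) A                      ∎
    where
    open ≡-Reasoning
    A′ : Matrix (suc (suc n))
    A′ Fin.zero    c = A (Fin.suc Fin.zero) c
    A′ (Fin.suc r) c = A (Fin.suc r) c
    distrib : ∀ s a b d → s * (a - b) * d ≡ s * a * d + - (s * b * d)
    distrib = solve-∀
    split : ∀ j → laplaceTerm B j ≡ laplaceTerm A j + - laplaceTerm A′ j
    split j rewrite changed j
                  | det-cong (suc n) {minor B j} {minor A j} (λ r c → same (Fin.suc r) (punchIn j c) (λ ()))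
      = distrib (sgn (toℕ j)) (A Fin.zero j) (A (Fin.suc Fin.zero) j) _
  det-subtractNextRow (suc n) (Fin.suc i) A B same changed = ΣFin-cong (suc (suc (suc n))) λ j →
    cong₂ _*_ (cong (sgn (toℕ j) *_) (same Fin.zero j (λ ())))
      (det-subtractNextRow n i (minor A j) (minor B j)
        (λ r c r≢i → same (Fin.suc r) (punchIn j c) (λ eq → r≢i (FinP.suc-injective eq)))
        (λ c → changed (punchIn j c)))

  det-1 : ∀ (A : Matrix 1) → det 1 A ≡ A Fin.zero Fin.zero
  det-1 A = lemma (A Fin.zero Fin.zero)
    where
    lemma : ∀ a → + 1 * a * + 1 + + 0 ≡ a
    lemma = solve-∀

  det-2 : ∀ (A : Matrix 2) → det 2 A ≡
    A Fin.zero Fin.zero * A (Fin.suc Fin.zero) (Fin.suc Fin.zero) - A Fin.zero (Fin.suc Fin.zero) * A (Fin.suc Fin.zero) Fin.zero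
  det-2 A = lemma (A Fin.zero Fin.zero) (A Fin.zero (Fin.suc Fin.zero)) (A (Fin.suc Fin.zero) Fin.zero) (A (Fin.suc Fin.zero) (Fin.suc Fin.zero))
    where
    lemma : ∀ a b c d → + 1 * a * (+ 1 * d * + 1 + + 0) + (- (+ 1) * b * (+ 1 * c * + 1 + + 0) + + 0) ≡ a * d - b * c
    lemma = solve-∀

  det-cornerRow : ∀ n (A : Matrix (suc (suc n))) → (∀ (c : Fin n) → A Fin.zero (Fin.suc (inject₁ c)) ≡ + 0) →
    det (suc (suc n)) A ≡ A Fin.zero Fin.zero * det (suc n) (minor A Fin.zero)
      + sgn (suc n) * A Fin.zero (fromℕ (suc n)) * det (suc n) (minor A (fromℕ (suc n)))
  det-cornerRow n A row = cong₂ _+_ first (begin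
    ΣFin (suc n) (λ j → laplaceTerm A (Fin.suc j))
      ≡⟨ ΣFin-last n (λ j → laplaceTerm A (Fin.suc j)) ⟩
    ΣFin n (λ j → laplaceTerm A (Fin.suc (inject₁ j))) + laplaceTerm A (fromℕ (suc n))
      ≡⟨ cong (_+ laplaceTerm A (fromℕ (suc n))) (ΣFin-zero n (λ j → term-entry-zero A (Fin.suc (inject₁ j)) (row j))) ⟩
    + 0 + laplaceTerm A (fromℕ (suc n))
      ≡⟨ ℤP.+-identityˡ _ ⟩
    laplaceTerm A (fromℕ (suc n))
      ≡⟨ cong (λ v → sgn v * A Fin.zero (fromℕ (suc n)) * det (suc n) (minor A (fromℕ (suc n)))) (FinP.toℕ-fromℕ (suc n)) ⟩
    sgn (suc n) * A Fin.zero (fromℕ (suc n)) * det (suc n) (minor A (fromℕ (suc n))) ∎)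
    where
    open ≡-Reasoning
    first : + 1 * A Fin.zero Fin.zero * det (suc n) (minor A Fin.zero) ≡ A Fin.zero Fin.zero * det (suc n) (minor A Fin.zero)
    first = cong (_* det (suc n) (minor A Fin.zero)) (ℤP.*-identityˡ (A Fin.zero Fin.zero))

  -- Expansion of a matrix whose first row vanishes beyond column 1 and whose first column
  -- vanishes below row 1 (the step of the three-term recurrence for tridiagonal determinants).
  det-tridiagonal : ∀ n (A : Matrix (suc (suc n))) →
    (∀ c → A Fin.zero (Fin.suc (Fin.suc c)) ≡ + 0) → (∀ r → A (Fin.suc (Fin.suc r)) Fin.zero ≡ + 0) →
    det (suc (suc n)) A ≡ A Fin.zero Fin.zero * det (suc n) (minor A Fin.zero)
      - A Fin.zero one * (A one Fin.zero * det n (minor (minor A Fin.zero) Fin.zero))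
  det-tridiagonal n A row col = begin
    + 1 * A Fin.zero Fin.zero * det (suc n) (minor A Fin.zero) + (laplaceTerm A one + rest)
      ≡⟨ cong (λ v → + 1 * A Fin.zero Fin.zero * det (suc n) (minor A Fin.zero) + v)
           (cong₂ _+_ (cong (sgn 1 * A Fin.zero one *_) (det-firstColumn n (minor A one) col))
                      (ΣFin-zero n (λ j → term-entry-zero A (Fin.suc (Fin.suc j)) (row j)))) ⟩
    + 1 * A Fin.zero Fin.zero * det (suc n) (minor A Fin.zero)
      + (- (+ 1) * A Fin.zero one * (A one Fin.zero * det n (minor (minor A Fin.zero) Fin.zero)) + + 0)
      ≡⟨ lemma (A Fin.zero Fin.zero) (det (suc n) (minor A Fin.zero)) (A Fin.zero one) (A one Fin.zero) _ ⟩
    A Fin.zero Fin.zero * det (suc n) (minor A Fin.zero)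
      - A Fin.zero one * (A one Fin.zero * det n (minor (minor A Fin.zero) Fin.zero)) ∎
    where
    open ≡-Reasoning
    rest : ℤ
    rest = ΣFin n (λ j → laplaceTerm A (Fin.suc (Fin.suc j)))
    lemma : ∀ a d b c e → + 1 * a * d + (- (+ 1) * b * (c * e) + + 0) ≡ a * d - b * (c * e)
    lemma = solve-∀

  block : (ℕ → ℕ → ℤ) → ℕ → ℕ → (k : ℕ) → Matrix k
  block Y r₀ c₀ k r c = Y (r₀ ℕ.+ toℕ r) (c₀ ℕ.+ toℕ c)

  block-minor₀ : ∀ Y r₀ c₀ k r c → minor (block Y r₀ c₀ (suc k)) Fin.zero r c ≡ block Y (suc r₀) (suc c₀) k r c
  block-minor₀ Y r₀ c₀ k r c = cong₂ Y (ℕP.+-suc r₀ (toℕ r)) (ℕP.+-suc c₀ (toℕ c))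

  det-block-minor₀ : ∀ Y r₀ c₀ k → det k (minor (block Y r₀ c₀ (suc k)) Fin.zero) ≡ det k (block Y (suc r₀) (suc c₀) k)
  det-block-minor₀ Y r₀ c₀ k = det-cong k (block-minor₀ Y r₀ c₀ k)

  det-block-minor₀₀ : ∀ Y r₀ c₀ k →
    det k (minor (minor (block Y r₀ c₀ (suc (suc k))) Fin.zero) Fin.zero) ≡ det k (block Y (suc (suc r₀)) (suc (suc c₀)) k)
  det-block-minor₀₀ Y r₀ c₀ k = det-cong k λ r c →
    trans (block-minor₀ Y r₀ c₀ (suc k) (Fin.suc r) (Fin.suc c)) (block-minor₀ Y (suc r₀) (suc c₀) k r c)

  toℕ-punchIn-last : ∀ k (c : Fin k) → toℕ (punchIn (fromℕ k) c) ≡ toℕ c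
  toℕ-punchIn-last (suc k) Fin.zero    = refl
  toℕ-punchIn-last (suc k) (Fin.suc c) = cong suc (toℕ-punchIn-last k c)

  det-block-minorLast : ∀ Y r₀ c₀ k → det k (minor (block Y r₀ c₀ (suc k)) (fromℕ k)) ≡ det k (block Y (suc r₀) c₀ k)
  det-block-minorLast Y r₀ c₀ k = det-cong k λ r c →
    cong₂ Y (ℕP.+-suc r₀ (toℕ r)) (cong (c₀ ℕ.+_) (toℕ-punchIn-last k c))

  rowDifferences : (ℕ → ℕ → ℤ) → ℕ → ℕ → ℕ → ℤ
  rowDifferences Y t r c = if r <ᵇ t then Y r c - Y (suc r) c else Y r c

  -- Row differences of any of the first n+1 rows leave the determinant of an (n+2)×(n+2) matrix unchanged
  -- (the rows are treated from the bottom up, so each step subtracts a row that is still original).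
  det-rowDifferences : ∀ n Y t → t ≤ suc n →
    det (suc (suc n)) (block (rowDifferences Y t) 0 0 (suc (suc n))) ≡ det (suc (suc n)) (block Y 0 0 (suc (suc n)))
  det-rowDifferences n Y zero    _   = refl
  det-rowDifferences n Y (suc t) t<n+1 =
    trans (det-subtractNextRow n i (block (rowDifferences Y t) 0 0 _) (block (rowDifferences Y (suc t)) 0 0 _) same changed)
          (det-rowDifferences n Y t (ℕP.≤-trans (ℕP.n≤1+n t) t<n+1))
    where
    i : Fin (suc n)
    i = fromℕ< t<n+1
    toℕ-i : toℕ (inject₁ i) ≡ t
    toℕ-i = trans (FinP.toℕ-inject₁ i) (FinP.toℕ-fromℕ< t<n+1)
    <ᵇ-other : ∀ x → ¬ (x ≡ t) → (x <ᵇ suc t) ≡ (x <ᵇ t)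
    <ᵇ-other x x≢t with ℕP.<-cmp x t
    ... | tri< x<t _ _ = trans (<ᵇ-true (ℕP.m<n⇒m<1+n x<t)) (sym (<ᵇ-true x<t))
    ... | tri≈ _ x≡t _ = contradiction x≡t x≢t
    ... | tri> _ _ x>t = trans (<ᵇ-false x>t) (sym (<ᵇ-false (ℕP.<⇒≤ x>t)))
    same : ∀ r c → ¬ (r ≡ inject₁ i) → rowDifferences Y (suc t) (toℕ r) (toℕ c) ≡ rowDifferences Y t (toℕ r) (toℕ c)
    same r c r≢i = cong (λ b → if b then Y (toℕ r) (toℕ c) - Y (suc (toℕ r)) (toℕ c) else Y (toℕ r) (toℕ c))
      (<ᵇ-other (toℕ r) (λ eq → r≢i (FinP.toℕ-injective (trans eq (sym toℕ-i)))))
    changed : ∀ c → rowDifferences Y (suc t) (toℕ (inject₁ i)) (toℕ c) ≡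
      rowDifferences Y t (toℕ (inject₁ i)) (toℕ c) - rowDifferences Y t (suc (toℕ i)) (toℕ c)
    changed c rewrite toℕ-i | FinP.toℕ-fromℕ< t<n+1 | <ᵇ-true {t} {suc t} ℕP.≤-refl | <ᵇ-false {t} {t} ℕP.≤-refl
      | <ᵇ-false {suc t} {t} (ℕP.n≤1+n t) = refl


module Derangement where

  open import Defs using (sgn; fallingQ; S)
  open Sums
  open NatFacts using (<ᵇ-true; <ᵇ-false)
  open import Data.Nat as ℕ using (ℕ; zero; suc; _≤_; _<_; z≤n; s≤s)
  import Data.Nat.Properties as ℕP
  open import Algebra.Properties.CommutativeSemigroup ℕP.*-commutativeSemigroup using (x∙yz≈y∙xz)
  open import Data.Nat.Divisibility using (_∣_; ∣n⇒∣m*n; m∣m*n; *-monoˡ-∣)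
  open import Data.Integer using (ℤ; +_; -_; _+_; _*_)
  import Data.Integer.Properties as ℤP
  open import Data.Sum using (inj₁; inj₂)
  open import Data.Empty using (⊥-elim)
  open import Relation.Binary.PropositionalEquality
  open import Data.Integer.Tactic.RingSolver using (solve-∀)

  fallingQ-self : ∀ k → fallingQ k k ≡ 1
  fallingQ-self zero    = refl
  fallingQ-self (suc k) rewrite <ᵇ-false {suc k} {suc k} ℕP.≤-refl = refl

  fallingQ-suc : ∀ k i → i ≤ k → fallingQ (suc k) i ≡ suc k ℕ.* fallingQ k i
  fallingQ-suc k i i≤k rewrite <ᵇ-true {i} {suc k} (s≤s i≤k) = refl

  fallingQ-step : ∀ k i → i < k → fallingQ k i ≡ suc i ℕ.* fallingQ k (suc i)
  fallingQ-step (suc k) i (s≤s i≤k) with ℕP.m≤n⇒m<n∨m≡n i≤k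
  ... | inj₂ refl = begin
    fallingQ (suc i) i               ≡⟨ fallingQ-suc i i ℕP.≤-refl ⟩
    suc i ℕ.* fallingQ i i           ≡⟨ cong (suc i ℕ.*_) (trans (fallingQ-self i) (sym (fallingQ-self (suc i)))) ⟩
    suc i ℕ.* fallingQ (suc i) (suc i) ∎
    where open ≡-Reasoning
  ... | inj₁ i<k = begin
    fallingQ (suc k) i                          ≡⟨ fallingQ-suc k i i≤k ⟩
    suc k ℕ.* fallingQ k i                      ≡⟨ cong (suc k ℕ.*_) (fallingQ-step k i i<k) ⟩
    suc k ℕ.* (suc i ℕ.* fallingQ k (suc i))    ≡⟨ x∙yz≈y∙xz (suc k) (suc i) _ ⟩
    suc i ℕ.* (suc k ℕ.* fallingQ k (suc i))    ≡⟨ cong (suc i ℕ.*_) (sym (fallingQ-suc k (suc i) i<k)) ⟩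
    suc i ℕ.* fallingQ (suc k) (suc i)          ∎
    where open ≡-Reasoning

  factor∣fallingQ : ∀ k i x → i < x → x ≤ k → x ∣ fallingQ k i
  factor∣fallingQ zero    i x i<x x≤0 = ⊥-elim (ℕP.<⇒≱ (ℕP.<-≤-trans i<x x≤0) z≤n)
  factor∣fallingQ (suc k) i x i<x x≤k+1 rewrite fallingQ-suc k i (ℕP.≤-pred (ℕP.<-≤-trans i<x x≤k+1))
    with ℕP.m≤n⇒m<n∨m≡n x≤k+1
  ... | inj₁ x<k+1 = ∣n⇒∣m*n (suc k) (factor∣fallingQ k i x i<x (ℕP.≤-pred x<k+1))
  ... | inj₂ refl  = m∣m*n (fallingQ k i)

  twoFactors∣fallingQ : ∀ k i a b → i < a → a < b → b ≤ k → a ℕ.* b ∣ fallingQ k i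
  twoFactors∣fallingQ zero    i a b i<a a<b b≤0 = ⊥-elim (ℕP.<⇒≱ (ℕP.<-trans i<a (ℕP.<-≤-trans a<b b≤0)) z≤n)
  twoFactors∣fallingQ (suc k) i a b i<a a<b b≤k+1
    rewrite fallingQ-suc k i (ℕP.≤-pred (ℕP.<-trans i<a (ℕP.<-≤-trans a<b b≤k+1)))
    with ℕP.m≤n⇒m<n∨m≡n b≤k+1
  ... | inj₁ b<k+1 = ∣n⇒∣m*n (suc k) (twoFactors∣fallingQ k i a b i<a a<b (ℕP.≤-pred b<k+1))
  ... | inj₂ refl  = subst (a ℕ.* suc k ∣_) (ℕP.*-comm (fallingQ k i) (suc k))
                       (*-monoˡ-∣ (suc k) (factor∣fallingQ k i a i<a (ℕP.≤-pred a<b)))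

  derangementTerm : ℕ → ℕ → ℤ
  derangementTerm k i = sgn i * + fallingQ k i

  S-rangeSum : ∀ k → S k ≡ rangeSum (derangementTerm k) 0 (suc k)
  S-rangeSum k = ΣFin-rangeSum (suc k) 0 (derangementTerm k)

  S-suc : ∀ k → S (suc k) ≡ + suc k * S k + sgn (suc k)
  S-suc k = begin
    S (suc k)
      ≡⟨ S-rangeSum (suc k) ⟩
    rangeSum (derangementTerm (suc k)) 0 (suc (suc k))
      ≡⟨ rangeSum-last (derangementTerm (suc k)) (suc k) 0 ⟩
    rangeSum (derangementTerm (suc k)) 0 (suc k) + derangementTerm (suc k) (suc k)
      ≡⟨ cong₂ _+_ (rangeSum-cong _ _ (suc k) 0 (λ i _ i≤k → scaled i (ℕP.≤-pred i≤k)))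
                   (trans (cong (λ v → sgn (suc k) * + v) (fallingQ-self (suc k))) (ℤP.*-identityʳ _)) ⟩
    rangeSum (λ i → + suc k * derangementTerm k i) 0 (suc k) + sgn (suc k)
      ≡⟨ cong (_+ sgn (suc k)) (sym (trans (cong (+ suc k *_) (S-rangeSum k)) (rangeSum-*ˡ (+ suc k) (derangementTerm k) (suc k) 0))) ⟩
    + suc k * S k + sgn (suc k) ∎
    where
    open ≡-Reasoning
    swap : ∀ a b c → a * (b * c) ≡ b * (a * c)
    swap = solve-∀
    scaled : ∀ i → i ≤ k → derangementTerm (suc k) i ≡ + suc k * derangementTerm k i
    scaled i i≤k = trans (cong (λ v → sgn i * v) (trans (cong +_ (fallingQ-suc k i i≤k)) (ℤP.pos-* (suc k) (fallingQ k i))))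
                         (swap (sgn i) (+ suc k) (+ fallingQ k i))

  -- The first two summands of S_{k+1} cancel: S_{k+1} = Σ_{i=2}^{k+1} (-1)^i (k+1)!/i!.
  S-from2 : ∀ k → S (suc k) ≡ rangeSum (derangementTerm (suc k)) 2 k
  S-from2 k = begin
    S (suc k)                                                                  ≡⟨ S-rangeSum (suc k) ⟩
    derangementTerm (suc k) 0 + (derangementTerm (suc k) 1 + rangeSum (derangementTerm (suc k)) 2 k)
      ≡⟨ sym (ℤP.+-assoc (derangementTerm (suc k) 0) _ _) ⟩
    derangementTerm (suc k) 0 + derangementTerm (suc k) 1 + rangeSum (derangementTerm (suc k)) 2 k
      ≡⟨ cong (_+ rangeSum (derangementTerm (suc k)) 2 k) firstTwo ⟩
    + 0 + rangeSum (derangementTerm (suc k)) 2 k                               ≡⟨ ℤP.+-identityˡ _ ⟩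
    rangeSum (derangementTerm (suc k)) 2 k                                     ∎
    where
    open ≡-Reasoning
    cancel : ∀ x → + 1 * x + - (+ 1) * x ≡ + 0
    cancel = solve-∀
    firstTwo : derangementTerm (suc k) 0 + derangementTerm (suc k) 1 ≡ + 0
    firstTwo = trans (cong (λ v → + 1 * + v + - (+ 1) * + fallingQ (suc k) 1)
                       (trans (fallingQ-step (suc k) 0 (s≤s z≤n)) (ℕP.*-identityˡ (fallingQ (suc k) 1))))
                     (cancel (+ fallingQ (suc k) 1))

  S-+4 : ∀ k → S (4 ℕ.+ k) ≡
    + (4 ℕ.+ k) * (+ (3 ℕ.+ k) * (+ (2 ℕ.+ k) * (+ (1 ℕ.+ k) * S k + sgn (1 ℕ.+ k)) + sgn (2 ℕ.+ k)) + sgn (3 ℕ.+ k)) + sgn (4 ℕ.+ k)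
  S-+4 k = begin
    S (4 ℕ.+ k)
      ≡⟨ S-suc (3 ℕ.+ k) ⟩
    + (4 ℕ.+ k) * S (3 ℕ.+ k) + sgn (4 ℕ.+ k)
      ≡⟨ cong (λ v → + (4 ℕ.+ k) * v + sgn (4 ℕ.+ k)) (S-suc (2 ℕ.+ k)) ⟩
    + (4 ℕ.+ k) * (+ (3 ℕ.+ k) * S (2 ℕ.+ k) + sgn (3 ℕ.+ k)) + sgn (4 ℕ.+ k)
      ≡⟨ cong (λ v → + (4 ℕ.+ k) * (+ (3 ℕ.+ k) * v + sgn (3 ℕ.+ k)) + sgn (4 ℕ.+ k)) (S-suc (1 ℕ.+ k)) ⟩
    + (4 ℕ.+ k) * (+ (3 ℕ.+ k) * (+ (2 ℕ.+ k) * S (1 ℕ.+ k) + sgn (2 ℕ.+ k)) + sgn (3 ℕ.+ k)) + sgn (4 ℕ.+ k)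
      ≡⟨ cong (λ v → + (4 ℕ.+ k) * (+ (3 ℕ.+ k) * (+ (2 ℕ.+ k) * v + sgn (2 ℕ.+ k)) + sgn (3 ℕ.+ k)) + sgn (4 ℕ.+ k)) (S-suc k) ⟩
    + (4 ℕ.+ k) * (+ (3 ℕ.+ k) * (+ (2 ℕ.+ k) * (+ (1 ℕ.+ k) * S k + sgn (1 ℕ.+ k)) + sgn (2 ℕ.+ k)) + sgn (3 ℕ.+ k)) + sgn (4 ℕ.+ k) ∎
    where open ≡-Reasoning


module KurepaMatrix where

  open import Defs using (entry)
  open NatFacts
  open Determinant using (rowDifferences)
  open import Data.Nat using (ℕ; suc; _≡ᵇ_; _≤ᵇ_; _≤_; _<_; _∸_; z≤n; s≤s)
  import Data.Nat.Properties as ℕP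
  open import Data.Bool using (true; false; if_then_else_)
  open import Data.Integer using (ℤ; +_; -_; _-_)
  import Data.Integer.Properties as ℤP
  open import Relation.Binary.PropositionalEquality
  open import Relation.Nullary using (yes; no)

  kurepa : ℕ → ℕ → ℕ → ℤ
  kurepa m r c = entry m (suc r) (suc c)

  entry-middle : ∀ m r c → (suc (suc r) ≡ᵇ m) ≡ false → entry m (suc (suc r)) c ≡
    (if c ≡ᵇ m then + 2
     else if suc (suc r) ≤ᵇ c then + 1
     else if suc c ≡ᵇ suc (suc r) then + (suc (suc (suc r)))
     else if suc (suc c) ≡ᵇ suc (suc r) then + 1
     else + 0)
  entry-middle m r c notLast rewrite notLast = refl

  entry-last : ∀ m r c → (suc (suc r) ≡ᵇ m) ≡ true → entry m (suc (suc r)) c ≡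
    (if c ≡ᵇ m then - (+ 4) else if suc c ≡ᵇ m then + 1 else + 0)
  entry-last m r c last rewrite last = refl

  kurepa-first-inner : ∀ m c → suc c < m → kurepa m 0 c ≡ + 1
  kurepa-first-inner m c c+1<m rewrite ≡ᵇ-false (ℕP.<⇒≢ c+1<m) = refl

  kurepa-first-last : ∀ m c → suc c ≡ m → kurepa m 0 c ≡ + 3
  kurepa-first-last m c c+1≡m rewrite ≡ᵇ-true c+1≡m = refl

  kurepa-middle-last : ∀ m r c → suc (suc r) < m → suc c ≡ m → kurepa m (suc r) c ≡ + 2
  kurepa-middle-last m r c mid c+1≡m
    rewrite entry-middle m r (suc c) (≡ᵇ-false (ℕP.<⇒≢ mid)) | ≡ᵇ-true c+1≡m = refl

  kurepa-middle-upper : ∀ m r c → suc (suc r) < m → suc r ≤ c → suc c < m → kurepa m (suc r) c ≡ + 1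
  kurepa-middle-upper m r c mid r<c c+1<m
    rewrite entry-middle m r (suc c) (≡ᵇ-false (ℕP.<⇒≢ mid)) | ≡ᵇ-false (ℕP.<⇒≢ c+1<m)
          | ≤ᵇ-true {suc (suc r)} {suc c} (s≤s r<c) = refl

  kurepa-middle-sub : ∀ m r → suc (suc r) < m → kurepa m (suc r) r ≡ + (suc (suc (suc r)))
  kurepa-middle-sub m r mid
    rewrite entry-middle m r (suc r) (≡ᵇ-false (ℕP.<⇒≢ mid))
          | ≡ᵇ-false {suc r} {m} (ℕP.<⇒≢ (ℕP.<-trans (ℕP.n<1+n _) mid))
          | ≤ᵇ-false {suc (suc r)} {suc r} ℕP.≤-refl | ≡ᵇ-true {suc (suc r)} refl = refl

  kurepa-middle-subsub : ∀ m c → suc (suc (suc c)) < m → kurepa m (suc (suc c)) c ≡ + 1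
  kurepa-middle-subsub m c mid
    rewrite entry-middle m (suc c) (suc c) (≡ᵇ-false (ℕP.<⇒≢ mid))
          | ≡ᵇ-false {suc c} {m} (ℕP.<⇒≢ (ℕP.<-trans (ℕP.n<1+n _) (ℕP.<-trans (ℕP.n<1+n _) mid)))
          | ≤ᵇ-false {suc (suc (suc c))} {suc c} (ℕP.m<n⇒m<1+n (ℕP.n<1+n _))
          | ≡ᵇ-false {suc (suc c)} {suc (suc (suc c))} (ℕP.<⇒≢ (ℕP.n<1+n _))
          | ≡ᵇ-true {suc (suc (suc c))} refl = refl

  kurepa-last-last : ∀ m r c → suc (suc r) ≡ m → suc c ≡ m → kurepa m (suc r) c ≡ - (+ 4)
  kurepa-last-last m r c last c+1≡m rewrite entry-last m r (suc c) (≡ᵇ-true last) | ≡ᵇ-true c+1≡m = refl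

  kurepa-last-sub : ∀ m r c → suc (suc r) ≡ m → suc (suc c) ≡ m → kurepa m (suc r) c ≡ + 1
  kurepa-last-sub m r c last c+2≡m
    rewrite entry-last m r (suc c) (≡ᵇ-true last)
          | ≡ᵇ-false {suc c} {m} (λ eq → ℕP.<-irrefl (trans eq (sym c+2≡m)) (ℕP.n<1+n _))
          | ≡ᵇ-true c+2≡m = refl

  kurepa-last-lower : ∀ m r c → suc (suc r) ≡ m → suc (suc c) < m → kurepa m (suc r) c ≡ + 0
  kurepa-last-lower m r c last c+2<m
    rewrite entry-last m r (suc c) (≡ᵇ-true last)
          | ≡ᵇ-false {suc c} {m} (ℕP.<⇒≢ (ℕP.<-trans (ℕP.n<1+n _) c+2<m))
          | ≡ᵇ-false {suc (suc c)} {m} (ℕP.<⇒≢ c+2<m) = refl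

  kurepa-lower : ∀ m r c → suc r < m → suc (suc c) < suc r → kurepa m (suc r) c ≡ + 0
  kurepa-lower m r c r+1<m below with suc (suc r) ℕP.<? m
  ... | yes mid
    rewrite entry-middle m r (suc c) (≡ᵇ-false (ℕP.<⇒≢ mid))
          | ≡ᵇ-false {suc c} {m} (ℕP.<⇒≢ (ℕP.<-trans (ℕP.<-trans (ℕP.n<1+n (suc c)) (ℕP.<-trans below (ℕP.n<1+n _))) mid))
          | ≤ᵇ-false {suc (suc r)} {suc c} (ℕP.<-trans (ℕP.n<1+n _) (ℕP.<-trans below (ℕP.n<1+n _)))
          | ≡ᵇ-false {suc (suc c)} {suc (suc r)} (ℕP.<⇒≢ (ℕP.<-trans below (ℕP.n<1+n _)))
          | ≡ᵇ-false {suc (suc (suc c))} {suc (suc r)} (ℕP.<⇒≢ (s≤s below)) = refl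
  ... | no ¬mid = kurepa-last-lower m r c (ℕP.≤-antisym r+1<m (ℕP.≮⇒≥ ¬mid)) (ℕP.<-trans below r+1<m)

  -- The reduced matrix: every row of M_N but the last replaced by its difference with the next row.
  -- Its determinant is K_N, and it is sparse enough to be expanded.
  reduced : ℕ → ℕ → ℕ → ℤ
  reduced m = rowDifferences (kurepa m) (m ∸ 1)

  reduced-difference : ∀ m r c → suc r < m → reduced m r c ≡ kurepa m r c - kurepa m (suc r) c
  reduced-difference (suc m) r c (s≤s r<m) rewrite <ᵇ-true r<m = refl

  reduced-lastRow : ∀ m r c → suc r ≡ m → reduced m r c ≡ kurepa m r c
  reduced-lastRow .(suc r) r c refl rewrite <ᵇ-false {r} {r} ℕP.≤-refl = refl

  -- With r+1 ≡ m-1 for the last row, its nonzero entries are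
  --   row 0:               -2 in column 0 and 1 in column m-1,
  --   row o+1, o+3 < m:    o+2 in column o and -(o+3) in column o+1,
  --   row o+2, o+3 < m:    additionally 1 in column o,
  --   row m-2:             m-1 in column m-3 and 6 in column m-1,
  --   row m-1:             1 in column m-2 and -4 in column m-1.
  private
    <-pred : ∀ {x m} → suc x < m → x < m
    <-pred = ℕP.<-trans (ℕP.n<1+n _)

  reduced-first-first : ∀ m → 2 < m → reduced m 0 0 ≡ - (+ 2)
  reduced-first-first m 2<m
    rewrite reduced-difference m 0 0 (<-pred 2<m) | kurepa-first-inner m 0 (<-pred 2<m) | kurepa-middle-sub m 0 2<m = refl

  reduced-first-inner : ∀ m c → 2 < m → suc (suc c) < m → reduced m 0 (suc c) ≡ + 0
  reduced-first-inner m c 2<m c+2<m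
    rewrite reduced-difference m 0 (suc c) (<-pred 2<m) | kurepa-first-inner m (suc c) c+2<m
          | kurepa-middle-upper m 0 (suc c) 2<m (s≤s z≤n) c+2<m = refl

  reduced-first-last : ∀ m c → 2 < m → suc c ≡ m → reduced m 0 c ≡ + 1
  reduced-first-last m c 2<m c+1≡m
    rewrite reduced-difference m 0 c (<-pred 2<m) | kurepa-first-last m c c+1≡m | kurepa-middle-last m 0 c 2<m c+1≡m = refl

  reduced-middle-sub : ∀ m o → suc (suc (suc o)) < m → reduced m (suc o) o ≡ + suc (suc o)
  reduced-middle-sub m o mid
    rewrite reduced-difference m (suc o) o (<-pred mid) | kurepa-middle-sub m o (<-pred mid) | kurepa-middle-subsub m o mid = refl

  reduced-middle-diag : ∀ m o → suc (suc (suc o)) < m → reduced m (suc o) (suc o) ≡ - (+ suc (suc (suc o)))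
  reduced-middle-diag m o mid
    rewrite reduced-difference m (suc o) (suc o) (<-pred mid) | kurepa-middle-upper m o (suc o) (<-pred mid) ℕP.≤-refl (<-pred mid)
          | kurepa-middle-sub m (suc o) mid = refl

  reduced-middle-upper : ∀ m o c → suc (suc (suc o)) < m → suc o < c → suc c < m → reduced m (suc o) c ≡ + 0
  reduced-middle-upper m o c mid o+1<c c+1<m
    rewrite reduced-difference m (suc o) c (<-pred mid) | kurepa-middle-upper m o c (<-pred mid) (<-pred o+1<c) c+1<m
          | kurepa-middle-upper m (suc o) c mid o+1<c c+1<m = refl

  reduced-middle-last : ∀ m o c → suc (suc (suc o)) < m → suc c ≡ m → reduced m (suc o) c ≡ + 0
  reduced-middle-last m o c mid c+1≡m
    rewrite reduced-difference m (suc o) c (<-pred mid) | kurepa-middle-last m o c (<-pred mid) c+1≡m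
          | kurepa-middle-last m (suc o) c mid c+1≡m = refl

  reduced-subsub : ∀ m o → suc (suc (suc o)) < m → reduced m (suc (suc o)) o ≡ + 1
  reduced-subsub m o mid
    rewrite reduced-difference m (suc (suc o)) o mid | kurepa-middle-subsub m o mid
          | kurepa-lower m (suc (suc o)) o mid (ℕP.n<1+n _) = refl

  reduced-lower : ∀ m o r → suc (suc o) < r → r < m → reduced m r o ≡ + 0
  reduced-lower m o (suc r) below r+1<m with suc (suc r) ℕP.<? m
  ... | yes r+2<m rewrite reduced-difference m (suc r) o r+2<m | kurepa-lower m r o r+1<m below
                        | kurepa-lower m (suc r) o r+2<m (ℕP.<-trans below (ℕP.n<1+n _)) = refl
  ... | no ¬r+2<m rewrite reduced-lastRow m (suc r) o (ℕP.≤-antisym r+1<m (ℕP.≮⇒≥ ¬r+2<m))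
                        | kurepa-lower m r o r+1<m below = refl

  reduced-corner-sub : ∀ m o → suc (suc (suc o)) ≡ m → reduced m (suc o) o ≡ + suc (suc (suc o))
  reduced-corner-sub m o corner
    rewrite reduced-difference m (suc o) o (ℕP.≤-reflexive corner) | kurepa-middle-sub m o (ℕP.≤-reflexive corner)
          | kurepa-last-lower m (suc o) o corner (ℕP.≤-reflexive corner) = ℤP.+-identityʳ _

  reduced-corner-diag : ∀ m o → suc (suc (suc o)) ≡ m → reduced m (suc o) (suc o) ≡ + 0
  reduced-corner-diag m o corner
    rewrite reduced-difference m (suc o) (suc o) (ℕP.≤-reflexive corner)
          | kurepa-middle-upper m o (suc o) (ℕP.≤-reflexive corner) ℕP.≤-refl (ℕP.≤-reflexive corner)
          | kurepa-last-sub m (suc o) (suc o) corner corner = refl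

  reduced-corner-last : ∀ m o → suc (suc (suc o)) ≡ m → reduced m (suc o) (suc (suc o)) ≡ + 6
  reduced-corner-last m o corner
    rewrite reduced-difference m (suc o) (suc (suc o)) (ℕP.≤-reflexive corner)
          | kurepa-middle-last m o (suc (suc o)) (ℕP.≤-reflexive corner) corner
          | kurepa-last-last m (suc o) (suc (suc o)) corner corner = refl

  reduced-last-sub : ∀ m r → suc (suc r) ≡ m → reduced m (suc r) r ≡ + 1
  reduced-last-sub m r last rewrite reduced-lastRow m (suc r) r last | kurepa-last-sub m r r last last = refl

  reduced-last-diag : ∀ m r → suc (suc r) ≡ m → reduced m (suc r) (suc r) ≡ - (+ 4)
  reduced-last-diag m r last rewrite reduced-lastRow m (suc r) (suc r) last | kurepa-last-last m r (suc r) last last = refl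

  reduced-last-lower : ∀ m r c → suc (suc r) ≡ m → suc (suc c) < m → reduced m (suc r) c ≡ + 0
  reduced-last-lower m r c last c+2<m rewrite reduced-lastRow m (suc r) c last | kurepa-last-lower m r c last c+2<m = refl


module Evaluation where

  open import Defs using (sgn; det; fallingQ; S; K)
  open Sums
  open Determinant
  open Derangement
  open KurepaMatrix
  open NatFacts using (≤-witness)
  open import Data.Nat as ℕ using (ℕ; zero; suc; _≤_; _<_; z≤n; s≤s)
  import Data.Nat.Properties as ℕP
  open import Data.Integer using (ℤ; +_; -_; _+_; _*_; _-_)
  import Data.Integer.Properties as ℤP
  open import Data.Fin as Fin using (Fin; toℕ)
  import Data.Fin.Properties as FinP
  open import Data.Product using (_×_; _,_; proj₁; proj₂)
  open import Relation.Binary.PropositionalEquality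
  open import Relation.Nullary using (yes; no)
  open import Data.Integer.Tactic.RingSolver using (solve-∀)
  open import Data.Nat.Tactic.RingSolver using () renaming (solve-∀ to solveℕ-∀)

  -- The trailing principal block of the reduced matrix, from diagonal position o+1 to the end (size k+2),
  -- is lower triangular with diagonal -(o+3), …, -(m-1), except for its final 2×2 block (0 6 / 1 -4);
  -- hence its determinant is (-1)^(k+1) · 6 · (o+3)(o+4)···(m-1).
  det-trailingBlock : ∀ m' k o → suc o ℕ.+ suc (suc k) ≡ suc m' →
    det (suc (suc k)) (block (reduced (suc m')) (suc o) (suc o) (suc (suc k)))
      ≡ sgn (suc k) * (+ 6 * + fallingQ m' (suc (suc o)))
  det-trailingBlock m' zero o size with ℕP.suc-injective (trans (cong suc (ℕP.+-comm 2 o)) size)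
  ... | refl rewrite fallingQ-self (suc (suc o)) = trans (det-2 B) corner
    where
    m : ℕ
    m = suc (suc (suc o))
    B : Matrix 2
    B = block (reduced m) (suc o) (suc o) 2
    corner : B Fin.zero Fin.zero * B one one - B Fin.zero one * B one Fin.zero ≡ - (+ 1) * (+ 6 * + 1)
    corner rewrite ℕP.+-identityʳ o | ℕP.+-comm o 1 =
      cong₂ _-_ (cong₂ _*_ (reduced-corner-diag m o refl) (reduced-last-diag m (suc o) refl))
                (cong₂ _*_ (reduced-corner-last m o refl) (reduced-last-sub m (suc o) refl))
  det-trailingBlock m' (suc k) o size = begin
    det (suc (suc (suc k))) B
      ≡⟨ det-firstRow (suc (suc k)) B firstRow ⟩
    B Fin.zero Fin.zero * det (suc (suc k)) (minor B Fin.zero)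
      ≡⟨ cong₂ _*_ diagonal (trans (det-block-minor₀ (reduced m) (suc o) (suc o) (suc (suc k)))
                                   (det-trailingBlock m' k (suc o) (trans (sym (ℕP.+-suc (suc o) (suc (suc k)))) size))) ⟩
    - (+ suc (suc (suc o))) * (sgn (suc k) * (+ 6 * + fallingQ m' (suc (suc (suc o)))))
      ≡⟨ reassociate (+ suc (suc (suc o))) (sgn (suc k)) (+ fallingQ m' (suc (suc (suc o)))) ⟩
    - sgn (suc k) * (+ 6 * (+ suc (suc (suc o)) * + fallingQ m' (suc (suc (suc o)))))
      ≡⟨ cong (λ v → - sgn (suc k) * (+ 6 * v)) (sym (trans (cong +_ (fallingQ-step m' (suc (suc o)) (ℕP.≤-pred o+3<m)))
                                                           (ℤP.pos-* (suc (suc (suc o))) (fallingQ m' (suc (suc (suc o))))))) ⟩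
    sgn (suc (suc k)) * (+ 6 * + fallingQ m' (suc (suc o))) ∎
    where
    open ≡-Reasoning
    m : ℕ
    m = suc m'
    B : Matrix (suc (suc (suc k)))
    B = block (reduced m) (suc o) (suc o) (suc (suc (suc k)))
    o+3<m : suc (suc (suc o)) < m
    o+3<m = subst (suc (suc (suc o)) <_) size
      (s≤s (ℕP.≤-trans (ℕP.≤-reflexive (ℕP.+-comm 3 o)) (ℕP.+-monoʳ-≤ o (ℕP.m≤m+n 3 k))))
    reassociate : ∀ a s F → - a * (s * (+ 6 * F)) ≡ - s * (+ 6 * (a * F))
    reassociate = solve-∀
    diagonal : B Fin.zero Fin.zero ≡ - (+ suc (suc (suc o)))
    diagonal rewrite ℕP.+-identityʳ o = reduced-middle-diag m o o+3<m
    firstRow : ∀ c → B Fin.zero (Fin.suc c) ≡ + 0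
    firstRow c rewrite ℕP.+-identityʳ o with suc (suc (o ℕ.+ suc (toℕ c))) ℕP.<? m
    ... | yes inside = reduced-middle-upper m o _ o+3<m (s≤s (subst (suc o ≤_) (sym (ℕP.+-suc o (toℕ c))) (s≤s (ℕP.m≤m+n o _)))) inside
    ... | no ¬inside = reduced-middle-last m o _ o+3<m (ℕP.≤-antisym inBlock (ℕP.≮⇒≥ ¬inside))
      where
      inBlock : suc (suc (o ℕ.+ suc (toℕ c))) ≤ m
      inBlock = subst (suc (suc (o ℕ.+ suc (toℕ c))) ≤_) size
        (s≤s (subst (_≤ o ℕ.+ suc (suc (suc k))) (ℕP.+-suc o (suc (toℕ c)))
          (ℕP.+-monoʳ-≤ o (s≤s (s≤s (ℕP.≤-pred (FinP.toℕ<n c)))))))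

  -- The block of the reduced matrix of size q+1 with top left corner (o+1, o), reaching the last row
  -- (o + q + 1 = m - 1), is tridiagonal: diagonal o+2, o+3, …, superdiagonal -(o+3), -(o+4), …,
  -- subdiagonal 1, 1, …, except that its last two rows end in (m, 0) and (0, 1).
  TridiagonalValue : ℕ → ℕ → Set
  TridiagonalValue m' q = ∀ o → o ℕ.+ suc q ≡ m' →
    sgn o * det (suc q) (block (reduced (suc m')) (suc o) o (suc q))
      ≡ + suc (suc m') * rangeSum (derangementTerm m') (suc (suc o)) q + sgn (suc m')

  -- Sizes 1 and 2 are the bottom right corner (1) and (m 0 / 0 1) of the tridiagonal block.
  tridiagonal-1 : ∀ m' → TridiagonalValue m' 0
  tridiagonal-1 m' o size with trans (ℕP.+-comm 1 o) size
  ... | refl = trans (cong (sgn o *_) (trans (det-1 (block (reduced (suc (suc o))) (suc o) o 1)) corner))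
                     (lemma (sgn o) (+ suc (suc (suc o))))
    where
    corner : reduced (suc (suc o)) (suc (o ℕ.+ 0)) (o ℕ.+ 0) ≡ + 1
    corner rewrite ℕP.+-identityʳ o = reduced-last-sub (suc (suc o)) o refl
    lemma : ∀ x M → x * + 1 ≡ M * + 0 + - - x
    lemma = solve-∀

  tridiagonal-2 : ∀ m' → TridiagonalValue m' 1
  tridiagonal-2 m' o size with trans (ℕP.+-comm 2 o) size
  ... | refl rewrite fallingQ-self (suc (suc o)) =
    trans (cong (sgn o *_) (trans (det-2 (block (reduced m) (suc o) o 2)) corner)) (lemma (sgn o) (+ o))
    where
    m : ℕ
    m = suc (suc (suc o))
    B : Matrix 2
    B = block (reduced m) (suc o) o 2
    corner : B Fin.zero Fin.zero * B one one - B Fin.zero one * B one Fin.zero ≡ (+ 3 + + o) * + 1 - + 0 * + 0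
    corner rewrite ℕP.+-identityʳ o | ℕP.+-comm o 1 =
      cong₂ _-_ (cong₂ _*_ (reduced-corner-sub m o refl) (reduced-last-sub m (suc o) refl))
                (cong₂ _*_ (reduced-corner-diag m o refl) (reduced-last-lower m (suc o) o refl ℕP.≤-refl))
    lemma : ∀ x O → x * ((+ 3 + O) * + 1 - + 0 * + 0) ≡ (+ 4 + O) * (- - x * + 1 + + 0) + - - - x
    lemma = solve-∀

  -- The three-term recurrence, combined with k!/(o+2)! = (o+3) · k!/(o+3)!.
  tridiagonal-step-algebra : ∀ X T₁ T₂ R F σ M O →
    - X * T₁ ≡ M * (- - - X * F + R) + σ → - - X * T₂ ≡ M * R + σ →
    X * ((+ 2 + O) * T₁ - (- (+ 3 + O)) * (+ 1 * T₂)) ≡ M * (- - X * ((+ 3 + O) * F) + (- - - X * F + R)) + σ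
  tridiagonal-step-algebra X T₁ T₂ R F σ M O eq₁ eq₂ = begin
    X * ((+ 2 + O) * T₁ - (- (+ 3 + O)) * (+ 1 * T₂))   ≡⟨ expand X T₁ T₂ O ⟩
    - (+ 2 + O) * (- X * T₁) + (+ 3 + O) * (- - X * T₂) ≡⟨ cong₂ (λ a b → - (+ 2 + O) * a + (+ 3 + O) * b) eq₁ eq₂ ⟩
    - (+ 2 + O) * (M * (- - - X * F + R) + σ) + (+ 3 + O) * (M * R + σ) ≡⟨ collect X R F σ M O ⟩
    M * (- - X * ((+ 3 + O) * F) + (- - - X * F + R)) + σ ∎
    where
    open ≡-Reasoning
    expand : ∀ X T₁ T₂ O → X * ((+ 2 + O) * T₁ - (- (+ 3 + O)) * (+ 1 * T₂)) ≡ - (+ 2 + O) * (- X * T₁) + (+ 3 + O) * (- - X * T₂)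
    expand = solve-∀
    collect : ∀ X R F σ M O → - (+ 2 + O) * (M * (- - - X * F + R) + σ) + (+ 3 + O) * (M * R + σ) ≡ M * (- - X * ((+ 3 + O) * F) + (- - - X * F + R)) + σ
    collect = solve-∀

  -- Expanding along the first row and column gives the three-term recurrence.
  tridiagonal-step : ∀ m' q → TridiagonalValue m' q → TridiagonalValue m' (suc q) → TridiagonalValue m' (suc (suc q))
  tridiagonal-step m' q value₀ value₁ o size = begin
    sgn o * det (suc (suc (suc q))) A
      ≡⟨ cong (sgn o *_) (det-tridiagonal (suc q) A firstRow firstColumn) ⟩
    sgn o * (A Fin.zero Fin.zero * det (suc (suc q)) (minor A Fin.zero)
               - A Fin.zero one * (A one Fin.zero * det (suc q) (minor (minor A Fin.zero) Fin.zero)))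
      ≡⟨ cong (sgn o *_) (cong₂ _-_ (cong₂ _*_ a₀₀ (det-block-minor₀ (reduced m) (suc o) o (suc (suc q))))
                                     (cong₂ _*_ a₀₁ (cong₂ _*_ a₁₀ (det-block-minor₀₀ (reduced m) (suc o) o (suc q))))) ⟩
    sgn o * ((+ 2 + + o) * T₁ - (- (+ 3 + + o)) * (+ 1 * T₂))
      ≡⟨ tridiagonal-step-algebra (sgn o) T₁ T₂ (rangeSum (derangementTerm m') (suc (suc (suc (suc o)))) q)
            (+ fallingQ m' (suc (suc (suc o)))) (sgn (suc m')) (+ suc (suc m')) (+ o)
            (value₁ (suc o) (trans (sym (ℕP.+-suc o (suc (suc q)))) size))
            (value₀ (suc (suc o)) (trans (shift o (suc q)) size)) ⟩
    + suc (suc m') * (- - sgn o * (+ suc (suc (suc o)) * + fallingQ m' (suc (suc (suc o))))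
                       + (- - - sgn o * + fallingQ m' (suc (suc (suc o))) + rangeSum (derangementTerm m') (suc (suc (suc (suc o)))) q))
      + sgn (suc m')
      ≡⟨ cong (λ v → + suc (suc m') * (- - sgn o * v + rest) + sgn (suc m'))
           (sym (trans (cong +_ (fallingQ-step m' (suc (suc o)) o+2<m')) (ℤP.pos-* (suc (suc (suc o))) (fallingQ m' (suc (suc (suc o))))))) ⟩
    + suc (suc m') * rangeSum (derangementTerm m') (suc (suc o)) (suc (suc q)) + sgn (suc m') ∎
    where
    open ≡-Reasoning
    m : ℕ
    m = suc m'
    A : Matrix (suc (suc (suc q)))
    A = block (reduced m) (suc o) o (suc (suc (suc q)))
    T₁ T₂ rest : ℤ
    T₁ = det (suc (suc q)) (block (reduced m) (suc (suc o)) (suc o) (suc (suc q)))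
    T₂ = det (suc q) (block (reduced m) (suc (suc (suc o))) (suc (suc o)) (suc q))
    rest = - - - sgn o * + fallingQ m' (suc (suc (suc o))) + rangeSum (derangementTerm m') (suc (suc (suc (suc o)))) q
    shift : ∀ o x → suc (suc o) ℕ.+ x ≡ o ℕ.+ suc (suc x)
    shift = solveℕ-∀
    shift₃ : ∀ o x → suc (suc (suc o)) ℕ.+ x ≡ o ℕ.+ suc (suc (suc x))
    shift₃ = solveℕ-∀
    o+2<m' : suc (suc o) < m'
    o+2<m' = subst (suc (suc o) <_) size (≤-witness (suc (suc (suc o))) q (shift₃ o q))
    mid : suc (suc (suc o)) < m
    mid = s≤s o+2<m'
    inside : ∀ x → x ≤ q → suc (suc (o ℕ.+ suc (suc x))) ≤ m
    inside x x≤q = s≤s (subst (suc (o ℕ.+ suc (suc x)) ≤_) size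
      (subst (_≤ o ℕ.+ suc (suc (suc q))) (ℕP.+-suc o (suc (suc x))) (ℕP.+-monoʳ-≤ o (s≤s (s≤s (s≤s x≤q))))))
    firstRow : ∀ c → A Fin.zero (Fin.suc (Fin.suc c)) ≡ + 0
    firstRow c rewrite ℕP.+-identityʳ o =
      reduced-middle-upper m o (o ℕ.+ suc (suc (toℕ c))) mid (≤-witness (suc (suc o)) (toℕ c) (shift o (toℕ c)))
        (inside (toℕ c) (ℕP.≤-pred (FinP.toℕ<n c)))
    firstColumn : ∀ r → A (Fin.suc (Fin.suc r)) Fin.zero ≡ + 0
    firstColumn r rewrite ℕP.+-identityʳ o =
      reduced-lower m o (suc (o ℕ.+ suc (suc (toℕ r))))
        (s≤s (≤-witness (suc (suc o)) (toℕ r) (shift o (toℕ r)))) (inside (toℕ r) (ℕP.≤-pred (FinP.toℕ<n r)))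
    a₀₀ : A Fin.zero Fin.zero ≡ + 2 + + o
    a₀₀ rewrite ℕP.+-identityʳ o = reduced-middle-sub m o mid
    a₀₁ : A Fin.zero one ≡ - (+ 3 + + o)
    a₀₁ rewrite ℕP.+-identityʳ o | ℕP.+-comm o 1 = reduced-middle-diag m o mid
    a₁₀ : A one Fin.zero ≡ + 1
    a₁₀ rewrite ℕP.+-identityʳ o | ℕP.+-comm o 1 = reduced-subsub m o mid

  det-tridiagonalBlock : ∀ m' q → TridiagonalValue m' q
  det-tridiagonalBlock m' q = proj₁ (consecutive q)
    where
    consecutive : ∀ q → TridiagonalValue m' q × TridiagonalValue m' (suc q)
    consecutive zero    = tridiagonal-1 m' , tridiagonal-2 m'
    consecutive (suc q) = proj₂ (consecutive q) , tridiagonal-step m' q (proj₁ (consecutive q)) (proj₂ (consecutive q))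

  -- Subtracting consecutive rows turns M_N into the reduced matrix, whose first row is (-2, 0, …, 0, 1);
  -- expanding along it leaves the trailing block and the tridiagonal block evaluated above.
  kurepa-closedForm : ∀ k → 2 ≤ k → K (5 ℕ.+ k) ≡ sgn k * (+ 12 * + fallingQ k 2 + + suc (suc k) * S k + sgn (suc k))
  kurepa-closedForm (suc zero) (s≤s ())
  kurepa-closedForm (suc (suc j)) _ = begin
    det m (block (kurepa m) 0 0 m)
      ≡⟨ sym (det-rowDifferences (suc j) (kurepa m) (suc (suc j)) ℕP.≤-refl) ⟩
    det m B
      ≡⟨ det-cornerRow (suc j) B firstRow ⟩
    B Fin.zero Fin.zero * det (suc (suc j)) (minor B Fin.zero)
      + sgn (suc (suc j)) * B Fin.zero (Fin.fromℕ (suc (suc j))) * det (suc (suc j)) (minor B (Fin.fromℕ (suc (suc j))))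
      ≡⟨ cong₂ _+_ (cong₂ _*_ (reduced-first-first m (s≤s (s≤s (s≤s z≤n))))
                              (trans (det-block-minor₀ (reduced m) 0 0 (suc (suc j))) (det-trailingBlock (suc (suc j)) j 0 refl)))
                   (cong₂ _*_ (cong (sgn (suc (suc j)) *_) lastEntry)
                              (trans (det-block-minorLast (reduced m) 0 0 (suc (suc j))) (sym (ℤP.*-identityˡ _)))) ⟩
    - (+ 2) * (sgn (suc j) * (+ 6 * + fallingQ (suc (suc j)) 2)) + sgn (suc (suc j)) * + 1 * (+ 1 * T)
      ≡⟨ combine (sgn j) (+ fallingQ (suc (suc j)) 2) T (+ suc (suc (suc (suc j)))) (S (suc (suc j)))
           (trans (det-tridiagonalBlock (suc (suc j)) (suc j) 0 refl)
                  (cong (λ v → + suc (suc (suc (suc j))) * v + sgn (suc (suc (suc j)))) (sym (S-from2 (suc j))))) ⟩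
    sgn (suc (suc j)) * (+ 12 * + fallingQ (suc (suc j)) 2 + + suc (suc (suc (suc j))) * S (suc (suc j)) + sgn (suc (suc (suc j)))) ∎
    where
    open ≡-Reasoning
    m : ℕ
    m = suc (suc (suc j))
    B : Matrix m
    B = block (reduced m) 0 0 m
    T : ℤ
    T = det (suc (suc j)) (block (reduced m) 1 0 (suc (suc j)))
    firstRow : ∀ (c : Fin (suc j)) → B Fin.zero (Fin.suc (Fin.inject₁ c)) ≡ + 0
    firstRow c rewrite FinP.toℕ-inject₁ c =
      reduced-first-inner m (toℕ c) (s≤s (s≤s (s≤s z≤n))) (s≤s (s≤s (FinP.toℕ<n c)))
    lastEntry : B Fin.zero (Fin.fromℕ (suc (suc j))) ≡ + 1
    lastEntry = trans (cong (reduced m 0) (FinP.toℕ-fromℕ (suc (suc j)))) (reduced-first-last m (suc (suc j)) (s≤s (s≤s (s≤s z≤n))) refl)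
    combine : ∀ σ F T M S → + 1 * T ≡ M * S + - - - σ →
      - (+ 2) * (- σ * (+ 6 * F)) + - - σ * + 1 * (+ 1 * T) ≡ - - σ * (+ 12 * F + M * S + - - - σ)
    combine σ F T M S eq = trans (cong (λ v → - (+ 2) * (- σ * (+ 6 * F)) + - - σ * + 1 * v) eq) (expand σ F M S)
      where
      expand : ∀ σ F M S → - (+ 2) * (- σ * (+ 6 * F)) + - - σ * + 1 * (M * S + - - - σ) ≡ - - σ * (+ 12 * F + M * S + - - - σ)
      expand = solve-∀


module NumberTheory where

  open import Defs using (fallingQ)
  open Derangement using (twoFactors∣fallingQ)
  open NatFacts using (≤-witness)
  open import Data.Nat using (ℕ; zero; suc; _+_; _*_; _%_; _≤_; _<_; z≤n; s≤s; nonTrivial⇒n>1)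
  import Data.Nat.Properties as ℕP
  open import Data.Nat.Divisibility using (_∣_; divides; n∣m⇒m%n≡0; ∣n⇒∣m*n; ∣-trans; m∣m*n)
  open import Data.Nat.Primality using (Composite; composite)
  open import Data.Nat.Tactic.RingSolver using (solve-∀)
  open import Data.Product using (∃₂; _×_; _,_)
  open import Relation.Binary.PropositionalEquality
  open import Relation.Binary.Definitions using (tri<; tri≈; tri>)
  open import Relation.Nullary using (contradiction)

  oddDivisor≥3 : ∀ {n d} → n % 2 ≡ 1 → d ∣ n → 1 < d → 3 ≤ d
  oddDivisor≥3 {n} {suc (suc zero)} odd 2∣n _ = contradiction (trans (sym (n∣m⇒m%n≡0 n 2 2∣n)) odd) λ ()
  oddDivisor≥3 {d = suc (suc (suc _))} _ _ _ = s≤s (s≤s (s≤s z≤n))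
  oddDivisor≥3 {d = suc zero} _ _ (s≤s ())

  oddComposite-factors : ∀ {n} → n % 2 ≡ 1 → 0 < n → Composite n → ∃₂ λ a b → 3 ≤ a × 3 ≤ b × n ≡ a * b
  oddComposite-factors {n} odd n>0 (composite {d} d<n (divides q n≡qd)) =
    q , d , oddDivisor≥3 odd (divides d (trans n≡qd (ℕP.*-comm q d))) (cofactor>1 q n≡qd)
          , oddDivisor≥3 odd (divides q n≡qd) (nonTrivial⇒n>1 d) , n≡qd
    where
    cofactor>1 : ∀ q → n ≡ q * d → 1 < q
    cofactor>1 zero            n≡0  = contradiction (subst (0 <_) n≡0 n>0) λ ()
    cofactor>1 (suc zero)      n≡d  = contradiction (subst (d <_) (trans n≡d (ℕP.+-identityʳ d)) d<n) (ℕP.<-irrefl refl)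
    cofactor>1 (suc (suc _)) _ = s≤s (s≤s z≤n)

  factor≤ : ∀ r s k → (3 + r) * (3 + s) ≡ 5 + k → 3 + s ≤ k
  factor≤ r s k eq = ≤-witness (3 + s) (1 + 3 * r + 2 * s + r * s) (ℕP.+-cancelˡ-≡ 5 _ _ (trans (expand r s) eq))
    where
    expand : ∀ r s → 5 + (3 + s + (1 + 3 * r + 2 * s + r * s)) ≡ (3 + r) * (3 + s)
    expand = solve-∀

  double≤ : ∀ t k → (5 + t) * (5 + t) ≡ 5 + k → (5 + t) + (5 + t) ≤ k
  double≤ t k eq = ≤-witness ((5 + t) + (5 + t)) (10 + 8 * t + t * t) (ℕP.+-cancelˡ-≡ 5 _ _ (trans (expand t) eq))
    where
    expand : ∀ t → 5 + ((5 + t) + (5 + t) + (10 + 8 * t + t * t)) ≡ (5 + t) * (5 + t)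
    expand = solve-∀

  -- Write N = (3+r)(3+s): for r ≠ s the two
  -- factors occur separately in 3·4···k = k!/2!; for r = s ≥ 2 so do a = 3+r and 2a; r = s = 0 is N = 9,
  -- and r = s = 1 would make N = 16 even.
  oddComposite∣fallingQ : ∀ n k → n ≡ 5 + k → n % 2 ≡ 1 → Composite n → n ∣ 96 * fallingQ k 2
  oddComposite∣fallingQ n k n≡5+k odd comp with oddComposite-factors odd (subst (0 <_) (sym n≡5+k) (s≤s z≤n)) comp
  ... | a , b , 3≤a , 3≤b , n≡ab with ℕP.m≤n⇒∃[o]m+o≡n 3≤a | ℕP.m≤n⇒∃[o]m+o≡n 3≤b
  ... | r , refl | s , refl =
    subst (_∣ 96 * fallingQ k 2) (sym n≡ab) (byFactors r s (trans (sym n≡ab) n≡5+k) (subst (λ x → x % 2 ≡ 1) n≡ab odd))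
    where
    2<3+ : ∀ x → 2 < 3 + x
    2<3+ x = s≤s (s≤s (s≤s z≤n))
    byFactors : ∀ r s → (3 + r) * (3 + s) ≡ 5 + k → ((3 + r) * (3 + s)) % 2 ≡ 1 → (3 + r) * (3 + s) ∣ 96 * fallingQ k 2
    byFactors r s eq odd with ℕP.<-cmp r s
    ... | tri< r<s _ _ = ∣n⇒∣m*n 96 (twoFactors∣fallingQ k 2 (3 + r) (3 + s) (2<3+ r) (s≤s (s≤s (s≤s r<s))) (factor≤ r s k eq))
    ... | tri> _ _ s<r = ∣n⇒∣m*n 96 (subst (_∣ fallingQ k 2) (ℕP.*-comm (3 + s) (3 + r))
            (twoFactors∣fallingQ k 2 (3 + s) (3 + r) (2<3+ s) (s≤s (s≤s (s≤s s<r)))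
              (factor≤ s r k (trans (ℕP.*-comm (3 + s) (3 + r)) eq))))
    byFactors zero .zero eq odd | tri≈ _ refl _ with ℕP.+-cancelˡ-≡ 5 4 k eq
    ... | refl = divides 128 refl
    byFactors (suc zero) .(suc zero) eq () | tri≈ _ refl _
    byFactors (suc (suc t)) .(suc (suc t)) eq odd | tri≈ _ refl _ =
      ∣n⇒∣m*n 96 (∣-trans (subst (u * u ∣_) (double u) (m∣m*n {u * u} 2))
        (twoFactors∣fallingQ k 2 u (u + u) (2<3+ (suc (suc t))) (ℕP.m<m+n u (s≤s z≤n)) (double≤ t k eq)))
      where
      u : ℕ
      u = 5 + t
      double : ∀ x → x * x * 2 ≡ x * (x + x)
      double = solve-∀



open import Defs
open Derangement using (S-+4)
open Evaluation using (kurepa-closedForm)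
open NumberTheory using (oddComposite∣fallingQ)
open import Data.Nat as ℕ using (ℕ; zero; suc; _≥_; _∸_; _%_; s≤s; z≤n)
import Data.Nat.Properties as ℕP
open import Data.Nat.DivMod using ([m+n]%n≡m%n)
open import Data.Nat.Primality using (Composite)
open import Data.Integer using (ℤ; +_; -_; _+_; _*_; _-_)
import Data.Integer.Properties as ℤP
open import Data.Integer.Divisibility using (_∣_)
open import Data.Integer.Divisibility.Signed as Signed using (divides; ∣ᵤ⇒∣; ∣⇒∣ᵤ; ∣m∣n⇒∣m+n)
open import Data.Integer.Tactic.RingSolver using (solve-∀)
open import Data.Product using (∃-syntax; _×_; _,_)
open import Relation.Binary.PropositionalEquality

sgn-+2 : ∀ k → sgn (2 ℕ.+ k) ≡ sgn k
sgn-+2 k = ℤP.neg-involutive (sgn k)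

oddForm : ∀ {n} → n ≥ 9 → n % 2 ≡ 1 → ∃[ k ] (n ≡ 5 ℕ.+ k × 2 ℕ.≤ k × sgn k ≡ + 1)
oddForm {n} n≥9 odd with ℕP.m≤n⇒∃[o]m+o≡n n≥9
... | d , refl = 4 ℕ.+ d , refl , s≤s (s≤s z≤n) , trans (sgn-+2 (2 ℕ.+ d)) (trans (sgn-+2 d) (even d odd))
  where
  even : ∀ d → (9 ℕ.+ d) % 2 ≡ 1 → sgn d ≡ + 1
  even zero          _   = refl
  even (suc zero)    ()
  even (suc (suc d)) odd = trans (sgn-+2 d)
    (even d (trans (sym ([m+n]%n≡m%n (9 ℕ.+ d) 2)) (trans (cong (_% 2) (ℕP.+-comm (9 ℕ.+ d) 2)) odd)))

-- The quotient of 8 K_n + S_{n-1} - 2 - 96 · (n-5)!/2! by n, as a polynomial in n and S_{n-5}.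
quotient : ℤ → ℤ → ℤ
quotient n s = (n * n - + 7 * n + + 14) * ((n - + 3) * s - + 1) - + 1

-- The polynomial identity behind the theorem, for n = k + 5 with σ = (-1)^k = 1: the closed form of
-- K_n, and S_{n-1} written through S_k by four steps of the recurrence.
congruence-identity : ∀ σ x F s → σ ≡ + 1 →
  + 8 * (σ * (+ 12 * F + (+ 2 + x) * s + - σ))
    - (- ((+ 4 + x) * ((+ 3 + x) * ((+ 2 + x) * ((+ 1 + x) * s + - σ) + - - σ) + - - - σ) + - - - - σ) + + 2)
  ≡ + 96 * F + (+ 5 + x) * quotient (+ 5 + x) s
congruence-identity .(+ 1) x F s refl = polynomial x F s
  where
  polynomial : ∀ x F s →
    + 8 * (+ 1 * (+ 12 * F + (+ 2 + x) * s + - + 1))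
      - (- ((+ 4 + x) * ((+ 3 + x) * ((+ 2 + x) * ((+ 1 + x) * s + - + 1) + - - + 1) + - - - + 1) + - - - - + 1) + + 2)
    ≡ + 96 * F + (+ 5 + x) * (((+ 5 + x) * (+ 5 + x) - + 7 * (+ 5 + x) + + 14) * (((+ 5 + x) - + 3) * s - + 1) - + 1)
  polynomial = solve-∀

congruence : ∀ n k → n ≡ 5 ℕ.+ k → 2 ℕ.≤ k → sgn k ≡ + 1 →
  + 8 * K n - (- S (n ∸ 1) + + 2) ≡ + 96 * + fallingQ k 2 + + n * quotient (+ n) (S k)
congruence .(5 ℕ.+ k) k refl 2≤k even = begin
  + 8 * K (5 ℕ.+ k) - (- S (4 ℕ.+ k) + + 2)
    ≡⟨ cong₂ (λ K′ S′ → + 8 * K′ - (- S′ + + 2)) (kurepa-closedForm k 2≤k) (S-+4 k) ⟩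
  + 8 * (sgn k * (+ 12 * + fallingQ k 2 + (+ 2 + + k) * S k + - sgn k))
    - (- ((+ 4 + + k) * ((+ 3 + + k) * ((+ 2 + + k) * ((+ 1 + + k) * S k + - sgn k) + - - sgn k) + - - - sgn k) + - - - - sgn k) + + 2)
    ≡⟨ congruence-identity (sgn k) (+ k) (+ fallingQ k 2) (S k) even ⟩
  + 96 * + fallingQ k 2 + (+ 5 + + k) * quotient (+ 5 + + k) (S k) ∎
  where open ≡-Reasoning

proposition4 : (n : ℕ) → n ≥ 9 → n % 2 ≡ 1 → Composite n →
    (+ n) ∣ ((+ 8 * K n) - (- S (n ∸ 1) + + 2))
proposition4 n n≥9 odd composite with oddForm n≥9 odd
... | k , n≡5+k , 2≤k , even =
  ∣⇒∣ᵤ (subst (Signed._∣_ (+ n)) (sym (congruence n k n≡5+k 2≤k even)) (∣m∣n⇒∣m+n n∣96F n∣nQ))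
  where
  F : ℕ
  F = fallingQ k 2
  n∣96F : Signed._∣_ (+ n) (+ 96 * + F)
  n∣96F = subst (Signed._∣_ (+ n)) (ℤP.pos-* 96 F) (∣ᵤ⇒∣ (oddComposite∣fallingQ n k n≡5+k odd composite))
  n∣nQ : Signed._∣_ (+ n) (+ n * quotient (+ n) (S k))
  n∣nQ = divides (quotient (+ n) (S k)) (ℤP.*-comm (+ n) _)
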